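{- Let $n\ge 1$ and $k\geq 3$ be integers, and let $m_1,\dots,m_n$ be integers with $m_i\geq k$ for $1\le i\le n$. Then $$\tau_k(K_{m_1}\Box K_{m_2}\Box \cdots \Box K_{m_n})\leq \sum_{i=1}^{n}m_i-n-k+2.$$
   Context: All graphs are finite, simple and undirected; $K_m$ is the complete graph on $m$ vertices. For a graph $G$ and a set $S\subseteq V(G)$ with $|S|\geq 2$, an $S$-Steiner tree is a subgraph $T$ of $G$ that is a tree with $S\subseteq V(T)$. A pendant $S$-Steiner tree is an $S$-Steiner tree in which every vertex of $S$ has degree exactly $1$. Two pendant $S$-Steiner trees $T,T'$ are internally disjoint if $E(T)\cap E(T')=\varnothing$ and $V(T)\cap V(T')=S$. The local pendant tree-connectivity $\tau_G(S)$ is the maximum number of pairwise internally disjoint pendant $S$-Steiner trees in $G$. For a graph $G$ of order $N$ and $2\le k\le N$, $\tau_k(G)=\min\{\tau_G(S): S\subseteq V(G),\ |S|=k\}$. The Cartesian product $G\Box H$ has vertex set $V(G)\times V(H)$, with $(u,v)$ adjacent to $(u',v')$ iff either $u=u'$ and $vv'\in E(H)$, or $v=v'$ and $uu'\in E(G)$; iterated products are formed by repeating this operation. -}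

module Defs where

open import Data.Nat using (ℕ; zero; suc; _+_; _∸_; _≤_)
open import Data.Fin using (Fin; inject₁; fromℕ)
import Data.Fin as F
open import Data.Product using (_×_; _,_; ∃)
open import Data.Sum using (_⊎_)
open import Data.Unit using (⊤)
open import Data.List using (List; []; _∷_; length; _++_; [_])
open import Data.List.Membership.Propositional using (_∈_)
open import Data.List.Relation.Unary.Unique.Propositional using (Unique)
open import Relation.Binary.PropositionalEquality using (_≡_; _≢_)
open import Relation.Nullary using (¬_)

record Graph : Set₁ where
  field
    V : Set
    Adj : V → V → Set
open Graph public

K : ℕ → Graph
K m = record { V = Fin m ; Adj = λ x y → x ≢ y }

_□_ : Graph → Graph → Graph
G □ H = record
  { V = V G × V H
  ; Adj = λ { (u , v) (u' , v') → (u ≡ u' × Adj H v v') ⊎ (v ≡ v' × Adj G u u') } }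

-- K_{m 0} □ K_{m 1} □ ... □ K_{m n}  (left-associated iterated product of n+1 factors)
KProd : (n : ℕ) → (Fin (suc n) → ℕ) → Graph
KProd zero m = K (m F.zero)
KProd (suc n) m = KProd n (λ i → m (inject₁ i)) □ K (m (fromℕ (suc n)))

ΣFin : (n : ℕ) → (Fin n → ℕ) → ℕ
ΣFin zero m = 0
ΣFin (suc n) m = m F.zero + ΣFin n (λ i → m (F.suc i))

record Sub (G : Graph) : Set where
  field
    vs : List (V G)
    es : List (V G × V G)
open Sub public

module _ {G : Graph} where

  EdgeT : Sub G → V G → V G → Set
  EdgeT T u v = ((u , v) ∈ es T) ⊎ ((v , u) ∈ es T)

  data Walk (T : Sub G) : V G → V G → Set where
    here : ∀ {u} → Walk T u u
    step : ∀ {u w v} → EdgeT T u w → Walk T w v → Walk T u v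

  Chain : (V G → V G → Set) → List (V G) → Set
  Chain R [] = ⊤
  Chain R (x ∷ []) = ⊤
  Chain R (x ∷ y ∷ rest) = R x y × Chain R (y ∷ rest)

  IsCycle : Sub G → V G → List (V G) → Set
  IsCycle T x xs = (2 ≤ length xs) × Unique (x ∷ xs) × Chain (EdgeT T) (x ∷ xs ++ [ x ])

  IsTree : Sub G → Set
  IsTree T =
    Unique (vs T)
    × (∀ {u v} → (u , v) ∈ es T → Adj G u v × u ∈ vs T × v ∈ vs T)
    × (∀ {u v} → u ∈ vs T → v ∈ vs T → Walk T u v)
    × (∀ x xs → ¬ IsCycle T x xs)

  Pendant : Sub G → V G → Set
  Pendant T s = ∃ (λ w → EdgeT T s w) × (∀ {w w'} → EdgeT T s w → EdgeT T s w' → w ≡ w')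

  PendantSteiner : List (V G) → Sub G → Set
  PendantSteiner S T = IsTree T × (∀ {s} → s ∈ S → s ∈ vs T × Pendant T s)

  InternallyDisjoint : List (V G) → Sub G → Sub G → Set
  InternallyDisjoint S T T' =
    (∀ {u v} → EdgeT T u v → ¬ EdgeT T' u v)
    × (∀ {v} → v ∈ vs T → v ∈ vs T' → v ∈ S)

  -- τ_G(S) ≤ b : every family of pairwise internally disjoint pendant
  -- S-Steiner trees has at most b members
  τ≤ : List (V G) → ℕ → Set
  τ≤ S b = ∀ (t : ℕ) (Ts : Fin t → Sub G)
           → (∀ i → PendantSteiner S (Ts i))
           → (∀ i j → i ≢ j → InternallyDisjoint S (Ts i) (Ts j))
           → t ≤ b

-- τ_k(G) ≤ b : min over k-subsets S of τ_G(S) is at most b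
τₖ≤ : (G : Graph) → ℕ → ℕ → Set
τₖ≤ G k b = ∃ λ (S : List (V G)) → Unique S × length S ≡ k × τ≤ {G} S b

-- Let S contain at least three distinct vertices and let s ∈ S.  In a
-- pendant S-Steiner tree the unique neighbour w of s lies outside S: otherwise
-- s and w both have degree one, so the tree is the single edge sw and cannot
-- reach a third vertex of S.  Internally disjoint trees share no edge, hence
-- their neighbours of s are pairwise distinct.  So τ_G(S) is at most the number
-- of neighbours of s outside S.
module Submission where

open import Defs
open import Data.Nat using (ℕ; zero; suc; _+_; _∸_; _≤_; _<_; z≤n; s≤s)
open import Data.Nat.Properties
open import Data.Nat.Tactic.RingSolver using (solve-∀)
open import Data.Fin using (Fin; toℕ; fromℕ<; inject≤; punchOut; inject₁; fromℕ)
import Data.Fin as F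
import Data.Fin.Properties as FP
open import Data.Product using (_×_; _,_; ∃; proj₁; proj₂)
open import Data.Sum using (_⊎_; inj₁; inj₂)
open import Data.Empty using (⊥; ⊥-elim)
open import Data.List using (tabulate)
open import Data.List.Properties using (length-tabulate)
open import Data.List.Membership.Propositional using (_∈_)
open import Data.List.Membership.Propositional.Properties using (∈-tabulate⁺)
open import Data.List.Relation.Unary.Unique.Propositional.Properties using (tabulate⁺)
open import Function using (_∘_)
open import Relation.Binary.Definitions using (Symmetric)
open import Relation.Binary.PropositionalEquality
open import Relation.Nullary using (¬_; yes; no)

module PendantTrees {G : Graph} where

  flip-edge : ∀ {T : Sub G} {u v} → EdgeT T u v → EdgeT T v u
  flip-edge (inj₁ uv) = inj₂ uv
  flip-edge (inj₂ vu) = inj₁ vu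

  edge-adjacent : Symmetric (Adj G) → ∀ {T : Sub G} → IsTree T
                → ∀ {u v} → EdgeT T u v → Adj G u v
  edge-adjacent sym-adj (_ , edges , _) (inj₁ uv) = proj₁ (edges uv)
  edge-adjacent sym-adj (_ , edges , _) (inj₂ vu) = sym-adj (proj₁ (edges vu))

  pendant-pair-closed : ∀ {T : Sub G} {s w} → EdgeT T s w → Pendant T s → Pendant T w
                      → ∀ {u v} → Walk T u v → u ≡ s ⊎ u ≡ w → v ≡ s ⊎ v ≡ w
  pendant-pair-closed sw ps pw here u∈sw = u∈sw
  pendant-pair-closed sw ps pw (step e rest) (inj₁ refl) =
    pendant-pair-closed sw ps pw rest (inj₂ (proj₂ ps e sw))
  pendant-pair-closed {T} sw ps pw (step e rest) (inj₂ refl) =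
    pendant-pair-closed sw ps pw rest (inj₁ (proj₂ pw e (flip-edge {T} sw)))

  neighbour-outside : ∀ {S T s s₁ s₂ w} → PendantSteiner S T
                    → s ∈ S → s₁ ∈ S → s₂ ∈ S → s₁ ≢ s → s₂ ≢ s → s₁ ≢ s₂
                    → EdgeT T s w → ¬ w ∈ S
  neighbour-outside {S} {T} {s} {w = w} (tree , pendant) s∈S s₁∈S s₂∈S s₁≢s s₂≢s s₁≢s₂ sw w∈S =
    s₁≢s₂ (trans (is-w s₁∈S s₁≢s) (sym (is-w s₂∈S s₂≢s)))
    where
    connected : ∀ {u v} → u ∈ vs T → v ∈ vs T → Walk T u v
    connected = proj₁ (proj₂ (proj₂ tree))
    is-w : ∀ {t} → t ∈ S → t ≢ s → t ≡ w
    is-w t∈S t≢s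
      with pendant-pair-closed sw (proj₂ (pendant s∈S)) (proj₂ (pendant w∈S))
             (connected (proj₁ (pendant s∈S)) (proj₁ (pendant t∈S))) (inj₁ refl)
    ... | inj₁ t≡s = ⊥-elim (t≢s t≡s)
    ... | inj₂ t≡w = t≡w

-- An injective code of the neighbours of x that are not Excluded into
-- {0, …, N-1}: x has at most N such neighbours.
record NbrCode (G : Graph) (x : V G) (Excluded : V G → Set) (N : ℕ) : Set where
  field
    code           : ∀ u → Adj G x u → ¬ Excluded u → ℕ
    code<          : ∀ u a o → code u a o < N
    code-injective : ∀ u u' a a' o o' → code u a o ≡ code u' a' o' → u ≡ u'
open NbrCode

Degree≤ : (G : Graph) → V G → ℕ → Set
Degree≤ G x N = NbrCode G x (λ _ → ⊥) N

exclude-more : ∀ {G x N} {P Q : V G → Set} → (∀ {u} → P u → Q u)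
             → NbrCode G x P N → NbrCode G x Q N
exclude-more P⇒Q c = record
  { code           = λ u a o → code c u a (o ∘ P⇒Q)
  ; code<          = λ u a o → code< c u a (o ∘ P⇒Q)
  ; code-injective = λ u u' a a' o o' → code-injective c u u' a a' (o ∘ P⇒Q) (o' ∘ P⇒Q)
  }

-- Each tree is sent
-- to the code of its neighbour of s; distinct trees give distinct neighbours
-- because they share no edge.
module _ {G : Graph} (sym-adj : Symmetric (Adj G)) where
  open PendantTrees {G}

  τ≤-by-neighbours : ∀ {S s s₁ s₂ B} → s ∈ S → s₁ ∈ S → s₂ ∈ S
                   → s₁ ≢ s → s₂ ≢ s → s₁ ≢ s₂
                   → NbrCode G s (_∈ S) B → τ≤ S B
  τ≤-by-neighbours {S} {s} {B = B} s∈S s₁∈S s₂∈S s₁≢s s₂≢s s₁≢s₂ c t Ts steiner disjoint =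
    FP.injective⇒≤ slot-injective
    where
    module _ (i : Fin t) where
      pendant : Pendant (Ts i) s
      pendant = proj₂ (proj₂ (steiner i) s∈S)
      nbr : V G
      nbr = proj₁ (proj₁ pendant)
      edge : EdgeT (Ts i) s nbr
      edge = proj₂ (proj₁ pendant)
      slot : Fin B
      slot = fromℕ< (code< c nbr (edge-adjacent sym-adj (proj₁ (steiner i)) edge)
                       (neighbour-outside (steiner i) s∈S s₁∈S s₂∈S s₁≢s s₂≢s s₁≢s₂ edge))

    slot-injective : ∀ {i j} → slot i ≡ slot j → i ≡ j
    slot-injective {i} {j} same with i F.≟ j
    ... | yes i≡j = i≡j
    ... | no i≢j  = ⊥-elim (proj₁ (disjoint i j i≢j) (edge i)
                      (subst (EdgeT (Ts j) s) (sym same-nbr) (edge j)))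
      where
      same-nbr : nbr i ≡ nbr j
      same-nbr = code-injective c _ _ _ _ _ _ (FP.fromℕ<-injective _ _ _ _ same)

  τₖ≤-by-neighbours : ∀ {k B} → 2 ≤ k → (f : Fin (suc k) → V G)
                    → (∀ {i j} → f i ≡ f j → i ≡ j)
                    → NbrCode G (f F.zero) (_∈ tabulate f) B → τₖ≤ G (suc k) B
  τₖ≤-by-neighbours {suc (suc k)} (s≤s (s≤s _)) f f-injective c =
    tabulate f , tabulate⁺ f-injective , length-tabulate f ,
    τ≤-by-neighbours (member F.zero) (member one) (member two)
      (apart (λ ())) (apart (λ ())) (apart (λ ())) c
    where
    one two : Fin (suc (suc (suc k)))
    one = F.suc F.zero
    two = F.suc (F.suc F.zero)
    member : ∀ i → f i ∈ tabulate f
    member i = ∈-tabulate⁺ {f = f} i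
    apart : ∀ {i j} → i ≢ j → f i ≢ f j
    apart i≢j = i≢j ∘ f-injective

τₖ≤-mono : ∀ {G k b b'} → b ≤ b' → τₖ≤ G k b → τₖ≤ G k b'
τₖ≤-mono b≤b' (S , unique , size , bound) =
  S , unique , size , λ t Ts steiner disjoint → ≤-trans (bound t Ts steiner disjoint) b≤b'

symmetric-K : ∀ {m} → Symmetric (Adj (K m))
symmetric-K x≢y = x≢y ∘ sym

-- Every vertex of K m has m - 1 neighbours: punch out the vertex itself.
degree-K : ∀ {m} (x : Fin m) → ∃ λ N → Degree≤ (K m) x N × N + 1 ≡ m
degree-K {suc m} x = m , nbr-code , +-comm m 1
  where
  nbr-code : Degree≤ (K (suc m)) x m
  nbr-code = record
    { code           = λ u x≢u _ → toℕ (punchOut x≢u)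
    ; code<          = λ u x≢u _ → FP.toℕ<n (punchOut x≢u)
    ; code-injective = λ u u' a a' _ _ same →
        FP.punchOut-injective a a' (FP.toℕ-injective same)
    }

-- Any vertex of K m has at most m - k neighbours among the vertices
-- numbered k or higher: shift their numbers down by k.
beyond-prefix-K : ∀ {m} k (x : Fin m) → NbrCode (K m) x (λ v → toℕ v < k) (m ∸ k)
beyond-prefix-K {m} k x = record
  { code           = λ v _ _ → toℕ v ∸ k
  ; code<          = λ v _ v≮k → ∸-monoˡ-< (FP.toℕ<n v) (≮⇒≥ v≮k)
  ; code-injective = λ v v' _ _ v≮k v'≮k same →
      FP.toℕ-injective (∸-cancelʳ-≡ (≮⇒≥ v≮k) (≮⇒≥ v'≮k) same)
  }

-- A neighbour of (x , y) in G □ H moves in exactly one coordinate; it is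
-- excluded when its moving coordinate is excluded in that factor.
ProductExcluded : ∀ {G H} → V G → V H → (V G → Set) → (V H → Set) → V (G □ H) → Set
ProductExcluded x y P Q (u , v) = (u ≡ x × Q v) ⊎ (v ≡ y × P u)

product-code : ∀ {G H x y P Q N M} → NbrCode G x P N → NbrCode H y Q M
             → NbrCode (G □ H) (x , y) (ProductExcluded {G} {H} x y P Q) (N + M)
product-code {G} {H} {x} {y} {P} {Q} {N} {M} cG cH = record
  { code = pcode ; code< = pcode< ; code-injective = pcode-injective }
  where
  Excl : V (G □ H) → Set
  Excl = ProductExcluded {G} {H} x y P Q
  pcode : ∀ w → Adj (G □ H) (x , y) w → ¬ Excl w → ℕ
  pcode (u , v) (inj₁ (refl , a)) o = N + code cH v a (o ∘ inj₁ ∘ (refl ,_))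
  pcode (u , v) (inj₂ (refl , a)) o = code cG u a (o ∘ inj₂ ∘ (refl ,_))

  pcode< : ∀ w a o → pcode w a o < N + M
  pcode< (u , v) (inj₁ (refl , a)) o = +-monoʳ-< N (code< cH v a _)
  pcode< (u , v) (inj₂ (refl , a)) o = <-≤-trans (code< cG u a _) (m≤m+n N M)

  offset-apart : ∀ {a b} → b < N → N + a ≢ b
  offset-apart b<N same = <⇒≱ b<N (subst (N ≤_) same (m≤m+n N _))

  pcode-injective : ∀ w w' a a' o o' → pcode w a o ≡ pcode w' a' o' → w ≡ w'
  pcode-injective (u , v) (u' , v') (inj₁ (refl , a)) (inj₁ (refl , a')) o o' same =
    cong (x ,_) (code-injective cH v v' a a' _ _ (+-cancelˡ-≡ N _ _ same))
  pcode-injective (u , v) (u' , v') (inj₂ (refl , a)) (inj₂ (refl , a')) o o' same =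
    cong (_, y) (code-injective cG u u' a a' _ _ same)
  pcode-injective (u , v) (u' , v') (inj₁ (refl , a)) (inj₂ (refl , a')) o o' same =
    ⊥-elim (offset-apart (code< cG u' a' _) same)
  pcode-injective (u , v) (u' , v') (inj₂ (refl , a)) (inj₁ (refl , a')) o o' same =
    ⊥-elim (offset-apart (code< cG u a _) (sym same))

symmetric-□ : ∀ {G H} → Symmetric (Adj G) → Symmetric (Adj H) → Symmetric (Adj (G □ H))
symmetric-□ sG sH (inj₁ (refl , a)) = inj₁ (refl , sH a)
symmetric-□ sG sH (inj₂ (refl , a)) = inj₂ (refl , sG a)

symmetric-KProd : ∀ n m → Symmetric (Adj (KProd n m))
symmetric-KProd zero    m = symmetric-K
symmetric-KProd (suc n) m = symmetric-□ (symmetric-KProd n _) symmetric-K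

-- ΣFin peels off the first term while KProd peels off the last factor.
ΣFin-snoc : ∀ n (m : Fin (suc n) → ℕ)
          → ΣFin (suc n) m ≡ ΣFin n (m ∘ inject₁) + m (fromℕ n)
ΣFin-snoc zero    m = +-comm (m F.zero) 0
ΣFin-snoc (suc n) m = trans (cong (m F.zero +_) (ΣFin-snoc n (m ∘ F.suc)))
                            (sym (+-assoc (m F.zero) _ _))

degree-KProd : ∀ n m (x : V (KProd n m))
             → ∃ λ N → Degree≤ (KProd n m) x N × N + suc n ≡ ΣFin (suc n) m
degree-KProd zero m x with degree-K x
... | N , c , N+1≡m = N , c , trans N+1≡m (sym (+-identityʳ _))
degree-KProd (suc n) m (x , y) with degree-KProd n (m ∘ inject₁) x | degree-K y
... | N , cx , eqx | M , cy , eqy =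
  N + M , exclude-more nothing-excluded (product-code cx cy) ,
  (begin
    N + M + suc (suc n)       ≡⟨ regroup N M n ⟩
    (N + suc n) + (M + 1)     ≡⟨ cong₂ _+_ eqx eqy ⟩
    ΣFin (suc n) (m ∘ inject₁) + m (fromℕ (suc n)) ≡⟨ sym (ΣFin-snoc (suc n) m) ⟩
    ΣFin (suc (suc n)) m      ∎)
  where
  open ≡-Reasoning
  nothing-excluded : ∀ {w} → ProductExcluded {KProd n (m ∘ inject₁)} {K _} x y _ _ w → ⊥
  nothing-excluded (inj₁ (_ , ()))
  nothing-excluded (inj₂ (_ , ()))
  regroup : ∀ N M n → N + M + suc (suc n) ≡ (N + suc n) + (M + 1)
  regroup = solve-∀

origin : ∀ n m → (∀ i → 1 ≤ m i) → V (KProd n m)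
origin zero    m nonempty = fromℕ< (nonempty F.zero)
origin (suc n) m nonempty =
  origin n (m ∘ inject₁) (nonempty ∘ inject₁) , fromℕ< (nonempty (fromℕ (suc n)))

module Prefix {k m : ℕ} (k≤m : k ≤ m) where

  prefix : Fin k → Fin m
  prefix j = inject≤ j k≤m

  prefix-injective : ∀ {i j} → prefix i ≡ prefix j → i ≡ j
  prefix-injective = FP.inject≤-injective k≤m k≤m _ _

  prefix-of : ∀ (v : Fin m) (v<k : toℕ v < k) → prefix (fromℕ< v<k) ≡ v
  prefix-of v v<k = FP.toℕ-injective (trans (FP.toℕ-inject≤ _ k≤m) (FP.toℕ-fromℕ< v<k))

budget : ∀ {N c m k Σ} → k ≤ m → N + c + m ≡ Σ → N + (m ∸ k) ≤ Σ + 2 ∸ (suc c + k)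
budget {N} {c} {m} {k} {Σ} k≤m total = m+n≤o⇒m≤o∸n (N + (m ∸ k)) (begin
  N + (m ∸ k) + (suc c + k)   ≡⟨ regroup N (m ∸ k) c k ⟩
  suc (N + c + (m ∸ k + k))   ≡⟨ cong (λ z → suc (N + c + z)) (m∸n+n≡m k≤m) ⟩
  suc (N + c + m)             ≡⟨ cong suc total ⟩
  suc Σ                       ≤⟨ n≤1+n (suc Σ) ⟩
  suc (suc Σ)                 ≡⟨ +-comm 2 Σ ⟩
  Σ + 2                       ∎)
  where
  open ≤-Reasoning
  regroup : ∀ N d c k → N + d + (suc c + k) ≡ suc (N + c + (d + k))
  regroup = solve-∀

-- S consists of the first k vertices of K m,
-- or of the K m-line through a vertex z of G; its first vertex has, outside S,
-- the m - k remaining line vertices and (in G □ K m) the neighbours of z in G.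

τₖ≤-prefix : ∀ {k m} → 2 ≤ k → (k<m : suc k ≤ m) → τₖ≤ (K m) (suc k) (m ∸ suc k)
τₖ≤-prefix {k} 2≤k k<m =
  τₖ≤-by-neighbours symmetric-K 2≤k prefix prefix-injective
    (exclude-more in-prefix (beyond-prefix-K (suc k) (prefix F.zero)))
  where
  open Prefix k<m
  in-prefix : ∀ {v} → toℕ v < suc k → v ∈ tabulate prefix
  in-prefix {v} v<k = subst (_∈ tabulate prefix) (prefix-of v v<k) (∈-tabulate⁺ {f = prefix} _)

τₖ≤-line : ∀ {G k m N} → Symmetric (Adj G) → (z : V G) → Degree≤ G z N
         → 2 ≤ k → (k<m : suc k ≤ m) → τₖ≤ (G □ K m) (suc k) (N + (m ∸ suc k))
τₖ≤-line {G} {k} {m} sym-adj z degree-z 2≤k k<m =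
  τₖ≤-by-neighbours (symmetric-□ sym-adj symmetric-K) 2≤k line line-injective
    (exclude-more on-line (product-code degree-z (beyond-prefix-K (suc k) (prefix F.zero))))
  where
  open Prefix k<m
  line : Fin (suc k) → V (G □ K m)
  line j = z , prefix j
  line-injective : ∀ {i j} → line i ≡ line j → i ≡ j
  line-injective = prefix-injective ∘ cong proj₂
  on-line : ∀ {w} → ProductExcluded {G} {K m} z (prefix F.zero) (λ _ → ⊥) (λ v → toℕ v < suc k) w
          → w ∈ tabulate line
  on-line {u , v} (inj₁ (refl , v<k)) =
    subst (_∈ tabulate line) (cong (z ,_) (prefix-of v v<k)) (∈-tabulate⁺ {f = line} _)
  on-line (inj₂ (_ , ()))

proposition3p7 : (n k : ℕ) (m : Fin (suc n) → ℕ) → 3 ≤ k → (∀ i → k ≤ m i)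
    → τₖ≤ (KProd n m) k (ΣFin (suc n) m + 2 ∸ (suc n + k))
proposition3p7 zero (suc k) m (s≤s 2≤k) k≤m =
  τₖ≤-mono (budget {N = 0} {c = 0} (k≤m F.zero) (sym (+-identityʳ _)))
    (τₖ≤-prefix 2≤k (k≤m F.zero))
proposition3p7 (suc n) (suc k) m (s≤s 2≤k) k≤m
  with degree-KProd n (m ∘ inject₁) (origin n (m ∘ inject₁) (λ i → ≤-trans (s≤s z≤n) (k≤m (inject₁ i))))
... | N , degree-z , degree-sum =
  τₖ≤-mono (budget (k≤m last) (trans (cong (_+ m last) degree-sum) (sym (ΣFin-snoc (suc n) m))))
    (τₖ≤-line (symmetric-KProd n (m ∘ inject₁)) _ degree-z 2≤k (k≤m last))
  where
  last : Fin (suc (suc n))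
  last = fromℕ (suc n)
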